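{- For all integers $k,n$ with $2\le k\le n$, there exists a graph $G$ of order $n$ with $\chi_i(G)=k$.
   Context: All graphs are finite, simple, undirected and connected. Private neighbors. For $S\subseteq V(G)$ and $v\in S$, $pn[v,S]=N[v]\setminus \bigcup_{u\in S\setminus\{v\}}N[u]$, where $N[\cdot]$ is the closed neighborhood. Irredundance. $S$ is irredundant if $pn[v,S]\ne\emptyset$ for all $v\in S$. It is maximal irredundant if $S$ is irredundant and no proper superset $S\cup\{w\}$ is irredundant. Irredundance coloring. An irredundance coloring of $G$ is a proper coloring for which some maximal irredundant set has all its vertices colored pairwise differently. $\chi_i(G)$ is the minimum number of colors in an irredundance coloring. -}

module Defs where

open import Data.Nat using (ℕ; suc; _<_)
open import Data.Fin using (Fin)
open import Data.Fin.Subset using (Subset; _∈_; _∉_; _∪_; ⁅_⁆)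
open import Data.Bool using (Bool; true; false)
open import Data.Product using (Σ; ∃; _×_; _,_)
open import Data.Sum using (_⊎_)
open import Relation.Nullary using (¬_)
open import Relation.Binary.PropositionalEquality using (_≡_; _≢_)

record Graph (n : ℕ) : Set where
  field
    adj   : Fin n → Fin n → Bool
    sym   : ∀ u v → adj u v ≡ adj v u
    irrefl : ∀ v → adj v v ≡ false

open Graph public

module _ {n : ℕ} (G : Graph n) where

  Adj : Fin n → Fin n → Set
  Adj u v = adj G u v ≡ true

  data Walk : Fin n → Fin n → Set where
    here : ∀ {v} → Walk v v
    step : ∀ {u w v} → Adj u w → Walk w v → Walk u v

  Connected : Set
  Connected = ∀ u v → Walk u v

  InClosedNbhd : Fin n → Fin n → Set
  InClosedNbhd w v = w ≡ v ⊎ Adj v w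

  PrivateNeighbor : Subset n → Fin n → Fin n → Set
  PrivateNeighbor S v w =
    InClosedNbhd w v × (∀ u → u ∈ S → u ≢ v → ¬ InClosedNbhd w u)

  Irredundant : Subset n → Set
  Irredundant S = ∀ v → v ∈ S → ∃ λ w → PrivateNeighbor S v w

  MaximalIrredundant : Subset n → Set
  MaximalIrredundant S =
    Irredundant S × (∀ w → w ∉ S → ¬ Irredundant (S ∪ ⁅ w ⁆))

  ProperColoring : (c : ℕ) → (Fin n → Fin c) → Set
  ProperColoring c f = ∀ u v → Adj u v → f u ≢ f v

  IrredundanceColoring : (c : ℕ) → (Fin n → Fin c) → Set
  IrredundanceColoring c f =
    ProperColoring c f ×
    (∃ λ S → MaximalIrredundant S ×
       (∀ u v → u ∈ S → v ∈ S → f u ≡ f v → u ≡ v))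

  HasIrredColoring : ℕ → Set
  HasIrredColoring c = ∃ λ (f : Fin n → Fin c) → IrredundanceColoring c f

  IrredChromatic≡ : ℕ → Set
  IrredChromatic≡ k = HasIrredColoring k × (∀ c → c < k → ¬ HasIrredColoring c)

-- Take the complete k-partite graph on n vertices with k − 1 singleton parts and one part
-- of size n − k + 1. A singleton part is a vertex adjacent to everything else, so on its
-- own it is a maximal irredundant set, trivially rainbow, and the graph is connected;
-- colouring each vertex by its part is proper with k colours, while one vertex from each
-- part forms a k-clique, so fewer colours are impossible.
module Submission where

open import Defs hiding (sym)
open import Data.Nat using (ℕ; suc; _+_; _≤_; _<_; s≤s)
open import Data.Nat.Properties using (m≤n⇒∃[o]m+o≡n)
open import Data.Fin using (Fin; _↑ˡ_; splitAt) renaming (zero to fzero; suc to fsuc)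
open import Data.Fin.Properties using (_≟_; pigeonhole; <⇒≢; splitAt-↑ˡ; splitAt⁻¹-↑ˡ)
open import Data.Fin.Subset using (_∈_; ⁅_⁆)
open import Data.Fin.Subset.Properties using (x∈⁅y⁆⇒x≡y; x∈⁅x⁆; x∈p∪q⁺)
open import Data.Bool using (not)
open import Data.Product using (Σ; _×_; _,_)
open import Data.Sum using (inj₁; inj₂; [_,_]′)
open import Function using (id; const; _∘_)
open import Function.Bundles using (mk⇔)
open import Relation.Nullary using (¬_; does; yes; no)
open import Relation.Nullary.Decidable using (dec-true; dec-false; does-⇔)
open import Relation.Binary.PropositionalEquality
  using (_≡_; _≢_; refl; sym; trans; cong; subst)

module _ {n : ℕ} (G : Graph n) where

  Universal : Fin n → Set
  Universal v = ∀ w → InClosedNbhd G w v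

  universal⇒connected : ∀ {v} → Universal v → Connected G
  universal⇒connected {v} univ u w = toHub (univ u) (fromHub (univ w))
    where
    fromHub : ∀ {x} → InClosedNbhd G x v → Walk G v x
    fromHub (inj₁ refl) = here
    fromHub (inj₂ v~x)  = step v~x here

    toHub : ∀ {x} → InClosedNbhd G x v → Walk G v w → Walk G x w
    toHub (inj₁ refl) walk = walk
    toHub {x} (inj₂ v~x) walk = step (trans (Graph.sym G x v) v~x) walk

  ⁅⁆-irredundant : ∀ v → Irredundant G ⁅ v ⁆
  ⁅⁆-irredundant v u u∈ = u , inj₁ refl , λ x x∈ x≢u _ →
    x≢u (trans (x∈⁅y⁆⇒x≡y v x∈) (sym (x∈⁅y⁆⇒x≡y v u∈)))

  -- The added vertex w has no private neighbour: v already dominates every vertex.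
  universal⇒maximalIrredundant : ∀ {v} → Universal v → MaximalIrredundant G ⁅ v ⁆
  universal⇒maximalIrredundant {v} univ = ⁅⁆-irredundant v , λ w w∉ irr →
    let (p , _ , private-p) = irr w (x∈p∪q⁺ (inj₂ (x∈⁅x⁆ w)))
    in private-p v (x∈p∪q⁺ (inj₁ (x∈⁅x⁆ v)))
         (λ v≡w → w∉ (subst (_∈ ⁅ v ⁆) v≡w (x∈⁅x⁆ v))) (univ p)

  universal⇒hasIrredColoring : ∀ {v c} (f : Fin n → Fin c) →
    Universal v → ProperColoring G c f → HasIrredColoring G c
  universal⇒hasIrredColoring {v} f univ proper =
    f , proper , ⁅ v ⁆ , universal⇒maximalIrredundant univ ,
    λ x y x∈ y∈ _ → trans (x∈⁅y⁆⇒x≡y v x∈) (sym (x∈⁅y⁆⇒x≡y v y∈))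

  Clique : ∀ {k} → (Fin k → Fin n) → Set
  Clique s = ∀ i j → i ≢ j → Adj G (s i) (s j)

  clique⇒¬properColoring : ∀ {k c} {s : Fin k → Fin n} → Clique s → c < k →
    (f : Fin n → Fin c) → ¬ ProperColoring G c f
  clique⇒¬properColoring {s = s} clique c<k f proper =
    let (i , j , i<j , fsi≡fsj) = pigeonhole c<k (f ∘ s)
    in proper (s i) (s j) (clique i j (<⇒≢ i<j)) fsi≡fsj

  clique⇒¬hasIrredColoring : ∀ {k c} {s : Fin k → Fin n} → Clique s → c < k →
    ¬ HasIrredColoring G c
  clique⇒¬hasIrredColoring clique c<k (f , proper , _) =
    clique⇒¬properColoring clique c<k f proper

module _ {n c : ℕ} (part : Fin n → Fin c) where

  completeMultipartite : Graph n
  completeMultipartite = record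
    { adj    = λ u v → not (does (part u ≟ part v))
    ; sym    = λ u v → cong not (does-⇔ (mk⇔ sym sym) (part u ≟ part v) (part v ≟ part u))
    ; irrefl = λ v → cong not (dec-true (part v ≟ part v) refl)
    }

  private
    G : Graph n
    G = completeMultipartite

  part-properColoring : ProperColoring G c part
  part-properColoring u v u~v same
    with () ← trans (sym u~v) (cong not (dec-true (part u ≟ part v) same))

  differentParts⇒adj : ∀ u v → part u ≢ part v → Adj G u v
  differentParts⇒adj u v different = cong not (dec-false (part u ≟ part v) different)

  singletonPart⇒universal : ∀ {v} → (∀ w → part w ≡ part v → w ≡ v) → Universal G v
  singletonPart⇒universal {v} singleton w with part w ≟ part v
  ... | yes same     = inj₁ (singleton w same)
  ... | no different = inj₂ (differentParts⇒adj v w (different ∘ sym))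

  transversal⇒clique : ∀ {s : Fin c → Fin n} → (∀ i → part (s i) ≡ i) → Clique G s
  transversal⇒clique {s} transversal i j i≢j =
    differentParts⇒adj (s i) (s j) λ same →
      i≢j (trans (sym (transversal i)) (trans same (transversal j)))

  completeMultipartite-irredChromatic : ∀ {v} {s : Fin c → Fin n} →
    (∀ w → part w ≡ part v → w ≡ v) → (∀ i → part (s i) ≡ i) →
    Connected G × IrredChromatic≡ G c
  completeMultipartite-irredChromatic {v} singleton transversal =
    universal⇒connected G univ ,
    universal⇒hasIrredColoring G part univ part-properColoring ,
    λ _ → clique⇒¬hasIrredColoring G (transversal⇒clique transversal)
    where
    univ : Universal G v
    univ = singletonPart⇒universal singleton

theorem4 : (k n : ℕ) → 2 ≤ k → k ≤ n →
    Σ (Graph n) (λ G → Connected G × IrredChromatic≡ G k)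
theorem4 k@(suc (suc _)) n (s≤s (s≤s _)) k≤n with r , refl ← m≤n⇒∃[o]m+o≡n k≤n =
  completeMultipartite part ,
  completeMultipartite-irredChromatic part {s = _↑ˡ r} singleton transversal
  where
  part : Fin (k + r) → Fin k
  part = [ id , const (fsuc fzero) ]′ ∘ splitAt k

  singleton : ∀ w → part w ≡ fzero → w ≡ fzero
  singleton w _ with splitAt k w in split
  singleton w refl | inj₁ _ = sym (splitAt⁻¹-↑ˡ split)

  transversal : ∀ i → part (i ↑ˡ r) ≡ i
  transversal i rewrite splitAt-↑ˡ k i r = refl
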